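{- There is no solution of $A^x + B^y = C^z$ with integers $x,y,z \geq 3$, at least one of $x,y,z$ equal to $6$, positive integers $A,B,C$ with $\gcd(A,B,C) > 1$, and $C^z \leq 2^{100}$, whose Pegg Value $\min(A,B,C)/\gcd(A,B,C)$ exceeds $63742$.
   Context: A Resultant Pegg Equation is a solution of $A^x+B^y=C^z$ with $x,y,z\ge 3$, $A,B,C$ positive integers and $\gcd(A,B,C)>1$. Its Pegg Value is $\min(A,B,C)/\gcd(A,B,C)$. An equation is "$\leq 2^{100}$" when $C^z \leq 2^{100}$. -}

module Defs where

open import Data.Nat using (ℕ; zero; suc; _+_; _*_; _^_; _≤_; _<_; _⊓_)
open import Data.Nat.GCD using (gcd)
open import Data.Nat.DivMod using (_/_)
open import Data.Product using (_×_)
open import Data.Sum using (_⊎_)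
open import Relation.Binary.PropositionalEquality using (_≡_)

gcd3 : ℕ → ℕ → ℕ → ℕ
gcd3 a b c = gcd (gcd a b) c

-- natural-number division with the convention m / 0 = 0
-- (only used with nonzero divisor: gcd of positive numbers is positive)
_div_ : ℕ → ℕ → ℕ
m div zero    = 0
m div (suc k) = m / suc k

-- Pegg Value: min(A,B,C) / gcd(A,B,C)  (exact, since gcd divides min)
peggValue : ℕ → ℕ → ℕ → ℕ
peggValue a b c = (a ⊓ b ⊓ c) div gcd3 a b c

IsResultantPegg : ℕ → ℕ → ℕ → ℕ → ℕ → ℕ → Set
IsResultantPegg A B C x y z =
  (A ^ x + B ^ y ≡ C ^ z) × (3 ≤ x) × (3 ≤ y) × (3 ≤ z) ×
  (0 < A) × (0 < B) × (0 < C) × (1 < gcd3 A B C)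

{-# OPTIONS --safe #-}
module Submission where

open import Defs
open import Data.Nat.Base using (ℕ; suc; _+_; _^_; _⊓_; _≤_; _<_; s≤s; NonZero)
open import Data.Nat.Properties
open import Data.Nat.DivMod using (_/_; /-mono-≤; /-monoˡ-≤)
open import Data.Product using (_,_)
open import Data.Sum using (_⊎_; inj₁; inj₂)
open import Relation.Binary.PropositionalEquality using (_≡_; refl)

-- The term with exponent 6 is at most C ^ z ≤ 2 ^ 100, so the smallest base is at most
-- 2 ^ (100/6) < 127486; dividing by a gcd of at least 2 leaves at most ⌊127485 / 2⌋ = 63742.

^-cancelʳ-≤ : ∀ n .{{_ : NonZero n}} {m o} → m ^ n ≤ o ^ n → m ≤ o
^-cancelʳ-≤ n mⁿ≤oⁿ = ≮⇒≥ λ o<m → <⇒≱ (^-monoˡ-< n o<m) mⁿ≤oⁿ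

⊓³-pow-≤-sum : ∀ {A B C x y z n} → A ^ x + B ^ y ≡ C ^ z →
               (x ≡ n ⊎ y ≡ n ⊎ z ≡ n) → (A ⊓ B ⊓ C) ^ n ≤ C ^ z
⊓³-pow-≤-sum {A} {B} {C} {x} {y} {z} {n} eq (inj₁ refl) = begin
  (A ⊓ B ⊓ C) ^ n ≤⟨ ^-monoˡ-≤ n (≤-trans (m⊓n≤m (A ⊓ B) C) (m⊓n≤m A B)) ⟩
  A ^ n           ≤⟨ m≤m+n (A ^ n) (B ^ y) ⟩
  A ^ n + B ^ y   ≡⟨ eq ⟩
  C ^ z           ∎
  where open ≤-Reasoning
⊓³-pow-≤-sum {A} {B} {C} {x} {y} {z} {n} eq (inj₂ (inj₁ refl)) = begin
  (A ⊓ B ⊓ C) ^ n ≤⟨ ^-monoˡ-≤ n (≤-trans (m⊓n≤m (A ⊓ B) C) (m⊓n≤n A B)) ⟩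
  B ^ n           ≤⟨ m≤n+m (B ^ n) (A ^ x) ⟩
  A ^ x + B ^ n   ≡⟨ eq ⟩
  C ^ z           ∎
  where open ≤-Reasoning
⊓³-pow-≤-sum {A} {B} {C} {n = n} eq (inj₂ (inj₂ refl)) =
  ^-monoˡ-≤ n (m⊓n≤n (A ⊓ B) C)

div-≤-half : ∀ m {g} → 1 < g → m div g ≤ m / 2
div-≤-half m {suc g} (s≤s 1≤g) = /-mono-≤ {o = suc g} {p = 2} (≤-refl {m}) (s≤s 1≤g)

lemma2 : (A B C x y z : ℕ) → IsResultantPegg A B C x y z →
           (x ≡ 6 ⊎ y ≡ 6 ⊎ z ≡ 6) → C ^ z ≤ 2 ^ 100 →
           peggValue A B C ≤ 63742
lemma2 A B C x y z (eq , _ , _ , _ , _ , _ , _ , 1<gcd) six Cᶻ≤2¹⁰⁰ = begin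
  peggValue A B C ≤⟨ div-≤-half (A ⊓ B ⊓ C) 1<gcd ⟩
  (A ⊓ B ⊓ C) / 2 ≤⟨ /-monoˡ-≤ 2 min≤127485 ⟩
  127485 / 2      ≡⟨⟩
  63742           ∎
  where
  open ≤-Reasoning
  2¹⁰⁰≤127485⁶ : 2 ^ 100 ≤ 127485 ^ 6
  2¹⁰⁰≤127485⁶ = ≤ᵇ⇒≤ (2 ^ 100) (127485 ^ 6) _
  min≤127485 : A ⊓ B ⊓ C ≤ 127485
  min≤127485 = ^-cancelʳ-≤ 6
    (≤-trans (⊓³-pow-≤-sum eq six) (≤-trans Cᶻ≤2¹⁰⁰ 2¹⁰⁰≤127485⁶))
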